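{- Let $f=f(x_1,\ldots,x_n)$ be a positive threshold non-split Boolean function with $k$ relevant variables, and suppose there exists $i\in[n]$ such that both $f_0=f_{|x_i=0}$ and $f_1=f_{|x_i=1}$ are split. Then the number of extremal points of $f$ is at least $k+2$.
   Context: $B=\{0,1\}$; for $x,y\in B^n$, $x\preceq y$ means $(x)_j=1$ implies $(y)_j=1$. $f$ is positive if $f(x)=1$ and $x\preceq y$ imply $f(y)=1$; threshold if there are reals $w_1,\dots,w_n,t$ with $f(x)=0\iff\sum_jw_jx_j\le t$. For a variable $x_j$ and $\alpha\in B$, $g_{|x_j=\alpha}$ is the function of the remaining variables obtained by fixing $x_j=\alpha$. A variable $x_j$ is relevant for $g$ if $g_{|x_j=0}\not\equiv g_{|x_j=1}$. $g$ is split if it has a variable $x_j$ with $g_{|x_j=0}\equiv 0$ or $g_{|x_j=1}\equiv 1$; otherwise non-split. Extremal points of a positive function are its $\preceq$-maximal false points and $\preceq$-minimal true points.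
   Formalization: The weights $w_1,\dots,w_n$ and the threshold $t$ of a threshold function are rational rather than real. -}

module Defs where

open import Data.Bool using (Bool; true; false; if_then_else_)
open import Data.Nat using (ℕ; zero; suc)
open import Data.Fin using (Fin)
open import Data.Vec using (Vec; []; _∷_; lookup; insertAt)
open import Data.Rational using (ℚ; 0ℚ; _+_; _≤_)
open import Data.Product using (Σ; ∃; _×_; _,_)
open import Data.Sum using (_⊎_)
open import Data.Empty using (⊥)
open import Relation.Nullary using (¬_)
open import Relation.Binary.PropositionalEquality using (_≡_)
open import Function.Bundles using (_⇔_)
open import Function.Definitions using (Injective)

Point : ℕ → Set
Point n = Vec Bool n

BF : ℕ → Set
BF n = Point n → Bool

_⪯_ : ∀ {n} → Point n → Point n → Set
x ⪯ y = ∀ j → lookup x j ≡ true → lookup y j ≡ true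

Positive : ∀ {n} → BF n → Set
Positive f = ∀ x y → f x ≡ true → x ⪯ y → f y ≡ true

wsum : ∀ {n} → Vec ℚ n → Point n → ℚ
wsum [] [] = 0ℚ
wsum (w ∷ ws) (b ∷ bs) = (if b then w else 0ℚ) + wsum ws bs

Threshold : ∀ {n} → BF n → Set
Threshold {n} f = Σ (Vec ℚ n) λ w → Σ ℚ λ t → ∀ x → (f x ≡ false ⇔ wsum w x ≤ t)

restrict : ∀ {m} → BF (suc m) → Fin (suc m) → Bool → BF m
restrict g j α y = g (insertAt y j α)

Relevant : ∀ {m} → BF (suc m) → Fin (suc m) → Set
Relevant g j = ¬ (∀ y → restrict g j false y ≡ restrict g j true y)

Split : ∀ {n} → BF n → Set
Split {zero} g = ⊥
Split {suc m} g = Σ (Fin (suc m)) λ j →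
  (∀ y → restrict g j false y ≡ false) ⊎ (∀ y → restrict g j true y ≡ true)

HasRelevantCount : ∀ {m} → BF (suc m) → ℕ → Set
HasRelevantCount {m} g k = Σ (Fin k → Fin (suc m)) λ ι →
  Injective _≡_ _≡_ ι × (∀ j → Relevant g j ⇔ ∃ λ a → ι a ≡ j)

MaxFalse : ∀ {n} → BF n → Point n → Set
MaxFalse f x = f x ≡ false × (∀ y → x ⪯ y → f y ≡ false → y ≡ x)

MinTrue : ∀ {n} → BF n → Point n → Set
MinTrue f x = f x ≡ true × (∀ y → y ⪯ x → f y ≡ true → y ≡ x)

Extremal : ∀ {n} → BF n → Point n → Set
Extremal f x = MaxFalse f x ⊎ MinTrue f x

AtLeastExtremal : ∀ {n} → BF n → ℕ → Set
AtLeastExtremal {n} f N = Σ (Fin N → Point n) λ e →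
  Injective _≡_ _≡_ e × (∀ a → Extremal f (e a))

{-# OPTIONS --safe #-}
module Submission where

-- We prove more: if f is positive with k sensitive variables and weights order these by
-- desirability (as they do for a threshold function), then f has at least k + 1 extremal
-- points, and at least k + 2 when f is non-split.  Induct on k and let u be a sensitive
-- variable of least weight.  Either every other sensitive variable stays sensitive in f|u=1,
-- or every one stays sensitive in f|u=0; the duality f ↦ ¬ f(¬ x), which exchanges maximal
-- false and minimal true points and the two restrictions, reduces the second case to the first.
-- The extremal points of f|u=1 lift injectively to extremal points of f (a minimal true point r
-- with f r = 0 is moved to r + e_u), and no lift is a maximal false point of f with x_u = 0;
-- such a point exists because u is sensitive.  If f is non-split but f|u=1 is split, say
-- f|u=1,v=1 ≡ 1, a second point outside the lifts is found: a minimal true point with x_u = 0,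
-- x_v = 1 if v is sensitive in f|u=0, and otherwise a second maximal false point with x_u = 0.

open import Defs
open import Data.Nat using (ℕ; zero; suc; _+_)
open import Data.Nat.Properties using (+-comm)
open import Data.Fin using (Fin; zero; suc; punchIn; punchOut)
open import Data.Fin.Properties
  using (_≟_; all?; any?; ¬∀⟶∃¬; punchIn-injective; punchInᵢ≢i; punchIn-punchOut)
open import Data.Fin.Subset.Properties using (anySubset?)
open import Data.Bool using (Bool; false; true; not; if_then_else_)
open import Data.Bool.Properties using (not-¬; ¬-not; not-involutive) renaming (_≟_ to _≟ᴮ_)
open import Data.Vec
  using (Vec; []; _∷_; lookup; tabulate; map; replicate; _[_]≔_; insertAt; removeAt)
open import Data.Vec.Properties
  using (tabulate∘lookup; tabulate-cong; lookup-map; lookup-replicate; lookup∘update; lookup∘update′;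
         []≔-lookup; []≔-idempotent; []≔-commutes; map-[]≔)
open import Data.List using (allFin)
open import Data.List.Membership.Propositional.Properties using (∈-allFin)
import Data.List.Relation.Unary.All as All
import Data.List.Extrema as Extrema
open import Data.Rational using (ℚ; 0ℚ; _≤_) renaming (_+_ to _+ℚ_)
import Data.Rational.Properties as ℚ
open import Data.Product using (Σ; ∃; _×_; _,_; proj₁; proj₂)
open import Data.Sum using (_⊎_; inj₁; inj₂; [_,_]′)
open import Data.Empty using (⊥-elim)
open import Function.Base using (id; _∘_; case_of_)
open import Function.Bundles using (_⇔_; mk⇔; Equivalence)
open import Function.Definitions using (Injective)
open import Function.Properties.Equivalence using () renaming (sym to ⇔-sym; trans to ⇔-trans)
open import Relation.Binary.Bundles using (DecTotalOrder)
open import Relation.Binary.PropositionalEquality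
  using (_≡_; _≢_; refl; sym; trans; cong; cong₂; subst; module ≡-Reasoning)
open import Relation.Nullary using (¬_; Dec; yes; no; contradiction)
open import Relation.Nullary.Decidable using (_×-dec_; ¬?; decidable-stable; toSum)

variable
  n : ℕ
  x y : Point n
  j : Fin n
  b : Bool

lookup-ext : (∀ j → lookup x j ≡ lookup y j) → x ≡ y
lookup-ext {x = x} {y} eq = begin
  x                   ≡⟨ tabulate∘lookup x ⟨
  tabulate (lookup x) ≡⟨ tabulate-cong eq ⟩
  tabulate (lookup y) ≡⟨ tabulate∘lookup y ⟩
  y                   ∎
  where open ≡-Reasoning

[]≔-id : lookup x j ≡ b → x [ j ]≔ b ≡ x
[]≔-id {x = x} {j} xj = trans (cong (x [ j ]≔_) (sym xj)) ([]≔-lookup x j)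

[]≔-injective : lookup x j ≡ lookup y j → x [ j ]≔ b ≡ y [ j ]≔ b → x ≡ y
[]≔-injective {x = x} {j} {y} {b} xj≡yj eq = begin
  x                             ≡⟨ []≔-lookup x j ⟨
  x [ j ]≔ lookup x j           ≡⟨ []≔-idempotent x j ⟨
  (x [ j ]≔ b) [ j ]≔ lookup x j ≡⟨ cong₂ (λ z c → z [ j ]≔ c) eq xj≡yj ⟩
  (y [ j ]≔ b) [ j ]≔ lookup y j ≡⟨ []≔-idempotent y j ⟩
  y [ j ]≔ lookup y j           ≡⟨ []≔-lookup y j ⟩
  y                             ∎
  where open ≡-Reasoning

[]≔-restore : ∀ (x : Point n) {i j} → i ≢ j → lookup x j ≡ b → ∀ c d →
              ((x [ i ]≔ c) [ j ]≔ d) [ j ]≔ b ≡ x [ i ]≔ c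
[]≔-restore x {i} {j} i≢j xj c d =
  trans ([]≔-idempotent (x [ i ]≔ c) j) ([]≔-id (trans (lookup∘update′ (i≢j ∘ sym) x c) xj))

replicate-⪯ : ∀ (x : Point n) → replicate n false ⪯ x
replicate-⪯ x j e = contradiction (trans (sym (lookup-replicate j false)) e) λ ()

⪯-trans : ∀ (x y z : Point n) → x ⪯ y → y ⪯ z → x ⪯ z
⪯-trans _ _ _ x⪯y y⪯z j = y⪯z j ∘ x⪯y j

∷-mono : ∀ {c} → (b ≡ true → c ≡ true) → x ⪯ y → (b ∷ x) ⪯ (c ∷ y)
∷-mono head tail zero    = head
∷-mono head tail (suc j) = tail j

[]≔-⪯ : ∀ (x y : Point n) j b →
        (∀ i → i ≢ j → lookup x i ≡ true → lookup y i ≡ true) → (b ≡ true → lookup y j ≡ true) →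
        (x [ j ]≔ b) ⪯ y
[]≔-⪯ x y j b off on i e with i ≟ j
... | yes refl = on (trans (sym (lookup∘update i x b)) e)
... | no i≢j   = off i i≢j (trans (sym (lookup∘update′ i≢j x b)) e)

⪯-[]≔ : ∀ (x y : Point n) j b →
        (∀ i → i ≢ j → lookup x i ≡ true → lookup y i ≡ true) → (lookup x j ≡ true → b ≡ true) →
        x ⪯ (y [ j ]≔ b)
⪯-[]≔ x y j b off on i e with i ≟ j
... | yes refl = trans (lookup∘update i y b) (on e)
... | no i≢j   = trans (lookup∘update′ i≢j y b) (off i i≢j e)

⪯-[]≔true : ∀ (x : Point n) j → x ⪯ (x [ j ]≔ true)
⪯-[]≔true x j = ⪯-[]≔ x x j true (λ _ _ → id) (λ _ → refl)

[]≔false-⪯ : ∀ (x : Point n) j → (x [ j ]≔ false) ⪯ x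
[]≔false-⪯ x j = []≔-⪯ x x j false (λ _ _ → id) λ ()

[]≔false-⪯-[]≔true : ∀ (x : Point n) j → (x [ j ]≔ false) ⪯ (x [ j ]≔ true)
[]≔false-⪯-[]≔true x j = ⪯-trans (x [ j ]≔ false) x (x [ j ]≔ true) ([]≔false-⪯ x j) (⪯-[]≔true x j)

[]≔-mono : ∀ (x y : Point n) j b → x ⪯ y → (x [ j ]≔ b) ⪯ (y [ j ]≔ b)
[]≔-mono x y j b x⪯y = []≔-⪯ x (y [ j ]≔ b) j b
  (λ i i≢j → trans (lookup∘update′ i≢j y b) ∘ x⪯y i) (trans (lookup∘update j y b))

[]≔true-⪯ : ∀ (x y : Point n) j → x ⪯ y → lookup y j ≡ true → (x [ j ]≔ true) ⪯ y
[]≔true-⪯ x y j x⪯y yj = []≔-⪯ x y j true (λ i _ → x⪯y i) (λ _ → yj)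

⪯-[]≔false : ∀ (x y : Point n) j → x ⪯ y → lookup x j ≡ false → x ⪯ (y [ j ]≔ false)
⪯-[]≔false x y j x⪯y xj = ⪯-[]≔ x y j false (λ i _ → x⪯y i) (⊥-elim ∘ not-¬ xj)

⪯-[]≔true⁻ : ∀ (x y : Point n) j → x ⪯ (y [ j ]≔ true) → lookup x j ≡ false → x ⪯ y
⪯-[]≔true⁻ x y j x⪯y₁ xj i e with i ≟ j
... | yes refl = contradiction e (not-¬ xj)
... | no i≢j   = trans (sym (lookup∘update′ i≢j y true)) (x⪯y₁ i e)

not-swap : ∀ {a c} → not a ≡ c → a ≡ not c
not-swap {a} e = trans (sym (not-involutive a)) (cong not e)

neg : Point n → Point n
neg = map not

lookup-neg : ∀ (x : Point n) j → lookup (neg x) j ≡ not (lookup x j)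
lookup-neg x j = lookup-map j not x

neg-involutive : ∀ (x : Point n) → neg (neg x) ≡ x
neg-involutive x = lookup-ext λ j → begin
  lookup (neg (neg x)) j ≡⟨ lookup-neg (neg x) j ⟩
  not (lookup (neg x) j) ≡⟨ cong not (lookup-neg x j) ⟩
  not (not (lookup x j)) ≡⟨ not-involutive (lookup x j) ⟩
  lookup x j             ∎
  where open ≡-Reasoning

neg-swap : neg x ≡ y → x ≡ neg y
neg-swap {x = x} refl = sym (neg-involutive x)

neg-injective : neg x ≡ neg y → x ≡ y
neg-injective {y = y} eq = trans (neg-swap eq) (neg-involutive y)

neg-[]≔ : ∀ (x : Point n) j b → neg (x [ j ]≔ b) ≡ neg x [ j ]≔ not b
neg-[]≔ x j b = map-[]≔ not x j

neg-antitone : ∀ (x y : Point n) → x ⪯ y → neg y ⪯ neg x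
neg-antitone x y x⪯y j e = trans (lookup-neg x j) (cong not xj)
  where
  yj : lookup y j ≡ false
  yj = not-swap (trans (sym (lookup-neg y j)) e)
  xj : lookup x j ≡ false
  xj = ¬-not λ xj → not-¬ (x⪯y j xj) yj

⪯-neg : ∀ (x y : Point n) → x ⪯ neg y → y ⪯ neg x
⪯-neg x y x⪯¬y = subst (_⪯ neg x) (neg-involutive y) (neg-antitone x (neg y) x⪯¬y)

neg-⪯ : ∀ (x y : Point n) → neg x ⪯ y → neg y ⪯ x
neg-⪯ x y ¬x⪯y = subst (neg y ⪯_) (neg-involutive x) (neg-antitone (neg x) y ¬x⪯y)

-- f|x_u=b kept on the whole cube (where u becomes irrelevant), so that the induction never
-- changes the dimension; `restrict` of Defs only reappears at the very end.
_⟨_≔_⟩ : BF n → Fin n → Bool → BF n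
(f ⟨ u ≔ b ⟩) x = f (x [ u ]≔ b)

dual : BF n → BF n
dual f x = not (f (neg x))

dual-involutive : ∀ (f : BF n) x → dual (dual f) x ≡ f x
dual-involutive f x = trans (not-involutive _) (cong f (neg-involutive x))

dual-neg : ∀ (f : BF n) x → dual f (neg x) ≡ not (f x)
dual-neg f x = cong (not ∘ f) (neg-involutive x)

dual-neg-[]≔ : ∀ (f : BF n) x j b → dual f (neg x [ j ]≔ b) ≡ not (f (x [ j ]≔ not b))
dual-neg-[]≔ f x j b = cong (not ∘ f) (begin
  neg (neg x [ j ]≔ b)     ≡⟨ neg-[]≔ (neg x) j b ⟩
  neg (neg x) [ j ]≔ not b ≡⟨ cong (_[ j ]≔ not b) (neg-involutive x) ⟩
  x [ j ]≔ not b           ∎)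
  where open ≡-Reasoning

dual-⟨≔⟩ : ∀ (f : BF n) u b x → (dual f ⟨ u ≔ b ⟩) x ≡ dual (f ⟨ u ≔ not b ⟩) x
dual-⟨≔⟩ f u b x = cong (not ∘ f) (neg-[]≔ x u b)

module _ {f : BF n} (pos : Positive f) where

  positive-false : f y ≡ false → x ⪯ y → f x ≡ false
  positive-false {y = y} {x} fy x⪯y = ¬-not λ fx → not-¬ (pos x y fx x⪯y) fy

  positive-⟨≔⟩ : ∀ u b → Positive (f ⟨ u ≔ b ⟩)
  positive-⟨≔⟩ u b x y fx x⪯y = pos (x [ u ]≔ b) (y [ u ]≔ b) fx ([]≔-mono x y u b x⪯y)

  dual-positive : Positive (dual f)
  dual-positive x y dx x⪯y = cong not (positive-false (not-swap dx) (neg-antitone x y x⪯y))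

  ≤-⟨≔true⟩ : ∀ u → f x ≡ true → (f ⟨ u ≔ true ⟩) x ≡ true
  ≤-⟨≔true⟩ {x = x} u fx = pos x (x [ u ]≔ true) fx (⪯-[]≔true x u)

  ⟨≔false⟩-≤-⟨≔true⟩ : ∀ u → (f ⟨ u ≔ false ⟩) x ≡ true → (f ⟨ u ≔ true ⟩) x ≡ true
  ⟨≔false⟩-≤-⟨≔true⟩ {x = x} u fx = pos (x [ u ]≔ false) (x [ u ]≔ true) fx ([]≔false-⪯-[]≔true x u)

-- Relevance with a witness; for positive f it agrees with `Relevant` (relevant⇔sensitive).
Sensitive : BF n → Fin n → Set
Sensitive f j = ∃ λ x → (f ⟨ j ≔ false ⟩) x ≡ false × (f ⟨ j ≔ true ⟩) x ≡ true

attains? : ∀ (g : BF n) c → Dec (∃ λ x → g x ≡ c)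
attains? g c = anySubset? λ x → g x ≟ᴮ c

sensitive? : ∀ (f : BF n) j → Dec (Sensitive f j)
sensitive? f j = anySubset? λ x → ((f ⟨ j ≔ false ⟩) x ≟ᴮ false) ×-dec ((f ⟨ j ≔ true ⟩) x ≟ᴮ true)

sensitive-cong : ∀ {f g : BF n} → (∀ x → f x ≡ g x) → Sensitive f j → Sensitive g j
sensitive-cong f≗g (x , f0 , f1) = x , trans (sym (f≗g _)) f0 , trans (sym (f≗g _)) f1

sensitive-dual : ∀ (f : BF n) → Sensitive f j → Sensitive (dual f) j
sensitive-dual {j = j} f (x , f0 , f1) =
  neg x , trans (dual-neg-[]≔ f x j false) (cong not f1) , trans (dual-neg-[]≔ f x j true) (cong not f0)

sensitive-dual⁻ : ∀ (f : BF n) → Sensitive (dual f) j → Sensitive f j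
sensitive-dual⁻ f = sensitive-cong (dual-involutive f) ∘ sensitive-dual (dual f)

sensitive-⟨≔⟩⁻ : ∀ (f : BF n) u b → Sensitive (f ⟨ u ≔ b ⟩) j → Sensitive f j × j ≢ u
sensitive-⟨≔⟩⁻ {j = j} f u b (x , f0 , f1) with j ≟ u
... | yes refl = contradiction f0 (not-¬ (trans (cong f (trans (same false) (sym (same true)))) f1))
  where
  same : ∀ c → (x [ j ]≔ c) [ j ]≔ b ≡ x [ j ]≔ b
  same c = []≔-idempotent x j
... | no j≢u = (x [ u ]≔ b , moved f0 , moved f1) , j≢u
  where
  moved : ∀ {c d} → f ((x [ j ]≔ c) [ u ]≔ b) ≡ d → f ((x [ u ]≔ b) [ j ]≔ c) ≡ d
  moved = trans (cong f ([]≔-commutes x u j (j≢u ∘ sym)))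

sensitive-⟨≔⟩-either : ∀ (f : BF n) u {v} → v ≢ u → Sensitive f v →
                       Sensitive (f ⟨ u ≔ false ⟩) v ⊎ Sensitive (f ⟨ u ≔ true ⟩) v
sensitive-⟨≔⟩-either f u {v} v≢u (x , f0 , f1) = either (lookup x u) (x , pinned f0 , pinned f1)
  where
  pinned : ∀ {c d} → f (x [ v ]≔ c) ≡ d → (f ⟨ u ≔ lookup x u ⟩) (x [ v ]≔ c) ≡ d
  pinned {c} = trans (cong f ([]≔-id (lookup∘update′ (v≢u ∘ sym) x c)))
  either : ∀ b → Sensitive (f ⟨ u ≔ b ⟩) v →
           Sensitive (f ⟨ u ≔ false ⟩) v ⊎ Sensitive (f ⟨ u ≔ true ⟩) v
  either false = inj₁
  either true  = inj₂

module _ {f : BF n} (pos : Positive f) where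

  insensitive-flat : ¬ Sensitive f j → ∀ x → f (x [ j ]≔ false) ≡ f (x [ j ]≔ true)
  insensitive-flat {j} ¬sensitive x with f (x [ j ]≔ false) in f0 | f (x [ j ]≔ true) in f1
  ... | false | false = refl
  ... | true  | true  = refl
  ... | false | true  = contradiction (x , f0 , f1) ¬sensitive
  ... | true  | false =
    contradiction (pos (x [ j ]≔ false) (x [ j ]≔ true) f0 ([]≔false-⪯-[]≔true x j)) (not-¬ f1)

  insensitive-invariant : ¬ Sensitive f j → ∀ x b → f (x [ j ]≔ b) ≡ f x
  insensitive-invariant {j} ¬sensitive x b = trans (flat b (lookup x j)) (cong f ([]≔-lookup x j))
    where
    flat : ∀ b c → f (x [ j ]≔ b) ≡ f (x [ j ]≔ c)
    flat false false = refl
    flat true  true  = refl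
    flat false true  = insensitive-flat ¬sensitive x
    flat true  false = sym (insensitive-flat ¬sensitive x)

NonSplitAt : BF n → Fin n → Set
NonSplitAt f j = (∃ λ x → (f ⟨ j ≔ false ⟩) x ≡ true) × (∃ λ x → (f ⟨ j ≔ true ⟩) x ≡ false)

NonSplit : BF n → Set
NonSplit f = ∀ j → NonSplitAt f j

Splits : BF n → Set
Splits f = ∃ λ j → (∀ x → (f ⟨ j ≔ false ⟩) x ≡ false) ⊎ (∀ x → (f ⟨ j ≔ true ⟩) x ≡ true)

nonSplitAt? : ∀ (f : BF n) j → Dec (NonSplitAt f j)
nonSplitAt? f j = attains? (f ⟨ j ≔ false ⟩) true ×-dec attains? (f ⟨ j ≔ true ⟩) false

nonSplit-or-splits : ∀ (f : BF n) → NonSplit f ⊎ Splits f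
nonSplit-or-splits {n} f with all? (nonSplitAt? f)
... | yes nonSplit = inj₁ nonSplit
... | no ¬nonSplit with ¬∀⟶∃¬ n _ (nonSplitAt? f) ¬nonSplit
...   | j , ¬both with attains? (f ⟨ j ≔ false ⟩) true
...     | no ¬low  = inj₂ (j , inj₁ λ x → ¬-not λ e → ¬low (x , e))
...     | yes low  = inj₂ (j , inj₂ λ x → ¬-not λ e → ¬both (low , x , e))

nonSplit-dual : ∀ (f : BF n) → NonSplit f → NonSplit (dual f)
nonSplit-dual f nonSplit j with nonSplit j
... | (x , fx) , (y , fy) =
  (neg y , trans (dual-neg-[]≔ f y j false) (cong not fy)) ,
  (neg x , trans (dual-neg-[]≔ f x j true) (cong not fx))

module _ {f : BF n} where

  maxFalse-dual : MaxFalse (dual f) y → MinTrue f (neg y)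
  maxFalse-dual {y = y} (dy , maximal) = not-swap dy , minimal
    where
    minimal : ∀ z → z ⪯ neg y → f z ≡ true → z ≡ neg y
    minimal z z⪯¬y fz = neg-swap (maximal (neg z) (⪯-neg z y z⪯¬y) (trans (dual-neg f z) (cong not fz)))

  minTrue-dual : MinTrue (dual f) y → MaxFalse f (neg y)
  minTrue-dual {y = y} (dy , minimal) = not-swap dy , maximal
    where
    maximal : ∀ z → neg y ⪯ z → f z ≡ false → z ≡ neg y
    maximal z ¬y⪯z fz = neg-swap (minimal (neg z) (neg-⪯ y z ¬y⪯z) (trans (dual-neg f z) (cong not fz)))

  extremal-dual : Extremal (dual f) y → Extremal f (neg y)
  extremal-dual (inj₁ maxFalse) = inj₂ (maxFalse-dual maxFalse)
  extremal-dual (inj₂ minTrue)  = inj₁ (minTrue-dual minTrue)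

  atLeastExtremal-dual : ∀ {N} → AtLeastExtremal (dual f) N → AtLeastExtremal f N
  atLeastExtremal-dual (e , e-injective , e-extremal) =
    neg ∘ e , e-injective ∘ neg-injective , extremal-dual ∘ e-extremal

extend : ∀ {f : BF n} {N} (E : AtLeastExtremal f N) {x} → Extremal f x → (∀ a → proj₁ E a ≢ x) →
         AtLeastExtremal f (suc N)
extend {n} {f} {N} (e , e-injective , e-extremal) {x} x-extremal x-new = e′ , e′-injective , e′-extremal
  where
  e′ : Fin (suc N) → Point n
  e′ zero    = x
  e′ (suc a) = e a
  e′-injective : Injective _≡_ _≡_ e′
  e′-injective {zero}  {zero}   _  = refl
  e′-injective {zero}  {suc a′} eq = contradiction (sym eq) (x-new a′)
  e′-injective {suc a} {zero}   eq = contradiction eq (x-new a)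
  e′-injective {suc a} {suc a′} eq = cong suc (e-injective eq)
  e′-extremal : ∀ a → Extremal f (e′ a)
  e′-extremal zero    = x-extremal
  e′-extremal (suc a) = e-extremal a

positive-∷ : ∀ {f : BF (suc n)} → Positive f → ∀ b → Positive (f ∘ (b ∷_))
positive-∷ pos b x y fx x⪯y = pos (b ∷ x) (b ∷ y) fx (∷-mono id x⪯y)

maxFalse-true∷ : ∀ {f : BF (suc n)} {q} → MaxFalse (f ∘ (true ∷_)) q → MaxFalse f (true ∷ q)
maxFalse-true∷ (fq , maximal) = fq , λ where
  (true ∷ y)  q⪯y fy → cong (true ∷_) (maximal y (q⪯y ∘ suc) fy)
  (false ∷ y) q⪯y _  → contradiction (q⪯y zero refl) λ ()

maxFalse-false∷ : ∀ {f : BF (suc n)} {q} → MaxFalse (f ∘ (false ∷_)) q →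
                  (∀ y → q ⪯ y → f (true ∷ y) ≡ true) → MaxFalse f (false ∷ q)
maxFalse-false∷ (fq , maximal) cannotRise = fq , λ where
  (false ∷ y) q⪯y fy → cong (false ∷_) (maximal y (q⪯y ∘ suc) fy)
  (true ∷ y)  q⪯y fy → contradiction (cannotRise y (q⪯y ∘ suc)) (not-¬ fy)

-- Meaningful only from a false point: each coordinate in turn is raised iff f stays false.
ascend : BF n → Point n → Point n
ascend {zero}  f []      = []
ascend {suc n} f (_ ∷ x) = not (f (true ∷ x)) ∷ ascend (f ∘ (not (f (true ∷ x)) ∷_)) x

ascend-⪰ : ∀ (f : BF n) x → f x ≡ false → x ⪯ ascend f x
ascend-⪰ {zero}  f []          _  ()
ascend-⪰ {suc n} f (true ∷ x)  fx rewrite fx = ∷-mono id (ascend-⪰ (f ∘ (true ∷_)) x fx)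
ascend-⪰ {suc n} f (false ∷ x) fx with f (true ∷ x) in f1x
... | false = ∷-mono (λ ()) (ascend-⪰ (f ∘ (true ∷_)) x f1x)
... | true  = ∷-mono id (ascend-⪰ (f ∘ (false ∷_)) x fx)

ascend-maxFalse : ∀ {f : BF n} → Positive f → ∀ x → f x ≡ false → MaxFalse f (ascend f x)
ascend-maxFalse {zero}      pos []          fx = fx , λ { [] _ _ → refl }
ascend-maxFalse {suc n}     pos (true ∷ x)  fx rewrite fx =
  maxFalse-true∷ (ascend-maxFalse (positive-∷ pos true) x fx)
ascend-maxFalse {suc n} {f} pos (false ∷ x) fx with f (true ∷ x) in f1x
... | false = maxFalse-true∷ (ascend-maxFalse (positive-∷ pos true) x f1x)
... | true  = maxFalse-false∷ (ascend-maxFalse (positive-∷ pos false) x fx) cannotRise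
  where
  q = ascend (f ∘ (false ∷_)) x
  cannotRise : ∀ y → q ⪯ y → f (true ∷ y) ≡ true
  cannotRise y q⪯y =
    pos (true ∷ x) (true ∷ y) f1x (∷-mono id (⪯-trans x q y (ascend-⪰ (f ∘ (false ∷_)) x fx) q⪯y))

descend : BF n → Point n → Point n
descend f x = neg (ascend (dual f) (neg x))

module _ {f : BF n} (pos : Positive f) (x : Point n) (fx : f x ≡ true) where

  private
    dual-false : dual f (neg x) ≡ false
    dual-false = trans (dual-neg f x) (cong not fx)

  descend-⪯ : descend f x ⪯ x
  descend-⪯ = neg-⪯ x (ascend (dual f) (neg x)) (ascend-⪰ (dual f) (neg x) dual-false)

  descend-minTrue : MinTrue f (descend f x)
  descend-minTrue = maxFalse-dual (ascend-maxFalse (dual-positive pos) (neg x) dual-false)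

extremal-exists : ∀ {f : BF n} → Positive f → ∀ x → ∃ (Extremal f)
extremal-exists {f = f} pos x with f x in fx
... | false = ascend f x , inj₁ (ascend-maxFalse pos x fx)
... | true  = descend f x , inj₂ (descend-minTrue pos x fx)

sensitive-maxFalse : ∀ {f : BF n} → Positive f → ∀ {u} → Sensitive f u →
                     ∃ λ q → MaxFalse f q × lookup q u ≡ false
sensitive-maxFalse {f = f} pos {u} (x , f0 , f1) =
  q , q-maxFalse , ¬-not λ qu → not-¬ (pos (x [ u ]≔ true) q f1 (x₁⪯q qu)) (proj₁ q-maxFalse)
  where
  x₀ = x [ u ]≔ false
  q = ascend f x₀
  q-maxFalse = ascend-maxFalse pos x₀ f0
  x₁⪯q : lookup q u ≡ true → (x [ u ]≔ true) ⪯ q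
  x₁⪯q qu = subst (_⪯ q) ([]≔-idempotent x u) ([]≔true-⪯ x₀ q u (ascend-⪰ f x₀ f0) qu)

-- Isbell's desirability order: c is at least as strong as a.
_≼[_]_ : Fin n → BF n → Fin n → Set
a ≼[ f ] c = ∀ z → lookup z a ≡ false → lookup z c ≡ false →
             (f ⟨ a ≔ true ⟩) z ≡ true → (f ⟨ c ≔ true ⟩) z ≡ true

-- With t = ¬z cleared at a and c, dual f at z + e_a and z + e_c is ¬ f at t + e_c and t + e_a.
≼-dual : ∀ (f : BF n) {a c} → a ≼[ f ] c → a ≼[ dual f ] c
≼-dual f {a} {c} a≼c z za zc dfa with a ≟ c
... | yes refl = dfa
... | no a≢c   = trans (dual-⟨≔⟩ f c true z) (cong not fc-false)
  where
  z̄ = neg z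
  t = (z̄ [ a ]≔ false) [ c ]≔ false
  t+a : t [ a ]≔ true ≡ z̄ [ c ]≔ false
  t+a = trans (cong (_[ a ]≔ true) ([]≔-commutes z̄ a c a≢c))
              ([]≔-restore z̄ (a≢c ∘ sym) (trans (lookup-neg z a) (cong not za)) false false)
  t+c : t [ c ]≔ true ≡ z̄ [ a ]≔ false
  t+c = []≔-restore z̄ a≢c (trans (lookup-neg z c) (cong not zc)) false false
  ta : lookup t a ≡ false
  ta = trans (lookup∘update′ a≢c (z̄ [ a ]≔ false) false) (lookup∘update a z̄ false)
  tc : lookup t c ≡ false
  tc = lookup∘update c (z̄ [ a ]≔ false) false
  fa-false : f (z̄ [ a ]≔ false) ≡ false
  fa-false = not-swap (trans (sym (dual-⟨≔⟩ f a true z)) dfa)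
  fc-false : f (z̄ [ c ]≔ false) ≡ false
  fc-false = ¬-not λ fc →
    not-¬ (subst (λ w → f w ≡ true) t+c (a≼c t ta tc (subst (λ w → f w ≡ true) (sym t+a) fc))) fa-false

≼-⟨≔⟩ : ∀ (f : BF n) {a c} u b → a ≢ u → c ≢ u → a ≼[ f ] c → a ≼[ f ⟨ u ≔ b ⟩ ] c
≼-⟨≔⟩ f {a} {c} u b a≢u c≢u a≼c z za zc fa =
  subst (λ w → f w ≡ true) ([]≔-commutes z u c (c≢u ∘ sym))
    (a≼c (z [ u ]≔ b) (trans (lookup∘update′ a≢u z b) za) (trans (lookup∘update′ c≢u z b) zc)
         (subst (λ w → f w ≡ true) ([]≔-commutes z a u a≢u) fa))

Regular : BF n → Set
Regular {n} f = Σ (Fin n → ℚ) λ w → ∀ a c → Sensitive f a → Sensitive f c → w a ≤ w c → a ≼[ f ] c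

regular-dual : ∀ (f : BF n) → Regular f → Regular (dual f)
regular-dual f (w , regular) = w , λ a c sa sc wa≤wc →
  ≼-dual f (regular a c (sensitive-dual⁻ f sa) (sensitive-dual⁻ f sc) wa≤wc)

regular-⟨≔⟩ : ∀ (f : BF n) u b → Regular f → Regular (f ⟨ u ≔ b ⟩)
regular-⟨≔⟩ f u b (w , regular) = w , λ a c sa sc wa≤wc →
  let (sa′ , a≢u) = sensitive-⟨≔⟩⁻ f u b sa
      (sc′ , c≢u) = sensitive-⟨≔⟩⁻ f u b sc
  in ≼-⟨≔⟩ f u b a≢u c≢u (regular a c sa′ sc′ wa≤wc)

wsum-[]≔true : ∀ (w : Vec ℚ n) z a → lookup z a ≡ false →
               wsum w (z [ a ]≔ true) ≡ lookup w a +ℚ wsum w z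
wsum-[]≔true (w ∷ ws) (false ∷ z) zero    refl = cong (w +ℚ_) (sym (ℚ.+-identityˡ (wsum ws z)))
wsum-[]≔true (w ∷ ws) (c ∷ z)     (suc a) za   = begin
  w′ +ℚ wsum ws (z [ a ]≔ true)    ≡⟨ cong (w′ +ℚ_) (wsum-[]≔true ws z a za) ⟩
  w′ +ℚ (lookup ws a +ℚ wsum ws z) ≡⟨ ℚ.+-assoc w′ (lookup ws a) (wsum ws z) ⟨
  (w′ +ℚ lookup ws a) +ℚ wsum ws z ≡⟨ cong (_+ℚ wsum ws z) (ℚ.+-comm w′ (lookup ws a)) ⟩
  (lookup ws a +ℚ w′) +ℚ wsum ws z ≡⟨ ℚ.+-assoc (lookup ws a) w′ (wsum ws z) ⟩
  lookup ws a +ℚ (w′ +ℚ wsum ws z) ∎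
  where
  open ≡-Reasoning
  w′ = if c then w else 0ℚ

threshold-regular : ∀ (f : BF n) → Threshold f → Regular f
threshold-regular f (w , t , false⇔below) = lookup w , λ a c _ _ wa≤wc z za zc fa → ¬-not λ fc →
  not-¬ fa (Equivalence.from (false⇔below (z [ a ]≔ true)) (begin
    wsum w (z [ a ]≔ true) ≡⟨ wsum-[]≔true w z a za ⟩
    lookup w a +ℚ wsum w z ≤⟨ ℚ.+-monoˡ-≤ (wsum w z) wa≤wc ⟩
    lookup w c +ℚ wsum w z ≡⟨ wsum-[]≔true w z c zc ⟨
    wsum w (z [ c ]≔ true) ≤⟨ Equivalence.to (false⇔below (z [ c ]≔ true)) fc ⟩
    t                      ∎))
  where open ℚ.≤-Reasoning

module _ {f : BF n} (pos : Positive f) {u v : Fin n} (u≼v : u ≼[ f ] v) (v≢u : v ≢ u)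
         (¬sensitive : ¬ Sensitive (f ⟨ u ≔ false ⟩) v) where

  private
    invariant : ∀ x b → (f ⟨ u ≔ false ⟩) (x [ v ]≔ b) ≡ (f ⟨ u ≔ false ⟩) x
    invariant = insensitive-invariant (positive-⟨≔⟩ pos u false) ¬sensitive

  ⟨≔true⟩-≤-⟨≔false⟩ : ∀ y → lookup y v ≡ false →
                       (f ⟨ u ≔ true ⟩) y ≡ true → (f ⟨ u ≔ false ⟩) y ≡ true
  ⟨≔true⟩-≤-⟨≔false⟩ y yv fy =
    trans (sym (invariant y true)) (trans (cong f ([]≔-commutes y v u v≢u)) raised)
    where
    raised : f ((y [ u ]≔ false) [ v ]≔ true) ≡ true
    raised = u≼v (y [ u ]≔ false) (lookup∘update u y false) (trans (lookup∘update′ v≢u y false) yv)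
                 (trans (cong f ([]≔-idempotent y u)) fy)

  sensitive-⟨≔true⟩ : ∀ {v′} → v′ ≢ v → Sensitive (f ⟨ u ≔ false ⟩) v′ → Sensitive (f ⟨ u ≔ true ⟩) v′
  sensitive-⟨≔true⟩ {v′} v′≢v (x , f0 , f1) =
    x₀ , low , ⟨≔false⟩-≤-⟨≔true⟩ pos u (trans (same true) f1)
    where
    x₀ = x [ v ]≔ false
    same : ∀ b → (f ⟨ u ≔ false ⟩) (x₀ [ v′ ]≔ b) ≡ (f ⟨ u ≔ false ⟩) (x [ v′ ]≔ b)
    same b = trans (cong (f ⟨ u ≔ false ⟩) ([]≔-commutes x v v′ (v′≢v ∘ sym)))
                   (invariant (x [ v′ ]≔ b) false)
    x₀v : lookup (x₀ [ v′ ]≔ false) v ≡ false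
    x₀v = trans (lookup∘update′ (v′≢v ∘ sym) x₀ false) (lookup∘update v x false)
    low : (f ⟨ u ≔ true ⟩) (x₀ [ v′ ]≔ false) ≡ false
    low = ¬-not λ high → not-¬ (trans (sym (same false)) (⟨≔true⟩-≤-⟨≔false⟩ _ x₀v high)) f0

Weakest : BF n → Fin n → Set
Weakest f u = ∀ v → Sensitive f v → u ≼[ f ] v

KeepsSensitive : BF n → Fin n → Bool → Set
KeepsSensitive f u b = ∀ v → Sensitive f v → v ≢ u → Sensitive (f ⟨ u ≔ b ⟩) v

weakest-dichotomy : ∀ {f : BF n} → Positive f → ∀ {u} → Weakest f u →
                    KeepsSensitive f u true ⊎ KeepsSensitive f u false
weakest-dichotomy {f = f} pos {u} weakest
  with any? (λ v → sensitive? f v ×-dec ¬? (v ≟ u) ×-dec ¬? (sensitive? (f ⟨ u ≔ true ⟩) v))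
... | no ¬lost = inj₁ λ v sv v≢u →
  decidable-stable (sensitive? (f ⟨ u ≔ true ⟩) v) λ ¬s₁ → ¬lost (v , sv , v≢u , ¬s₁)
... | yes (v′ , sv′ , v′≢u , ¬s₁′) = inj₂ λ v sv v≢u →
  decidable-stable (sensitive? (f ⟨ u ≔ false ⟩) v) λ ¬s₀ →
    ¬s₁′ (sensitive-⟨≔true⟩ pos (weakest v sv) v≢u ¬s₀ (λ { refl → ¬s₀ s₀′ }) s₀′)
  where
  s₀′ : Sensitive (f ⟨ u ≔ false ⟩) v′
  s₀′ with sensitive-⟨≔⟩-either f u v′≢u sv′
  ... | inj₁ s₀ = s₀
  ... | inj₂ s₁ = contradiction s₁ ¬s₁′

keepsSensitive-dual : ∀ (f : BF n) u → KeepsSensitive f u false → KeepsSensitive (dual f) u true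
keepsSensitive-dual f u keeps v sv v≢u =
  sensitive-cong (sym ∘ dual-⟨≔⟩ f u true)
    (sensitive-dual (f ⟨ u ≔ false ⟩) (keeps v (sensitive-dual⁻ f sv) v≢u))

module Lift {f : BF n} (pos : Positive f) (u : Fin n) where

  f₁ : BF n
  f₁ = f ⟨ u ≔ true ⟩

  f₁-[]≔ : ∀ x c → f₁ (x [ u ]≔ c) ≡ f₁ x
  f₁-[]≔ x c = cong f ([]≔-idempotent x u)

  maxFalse₁-u : ∀ {q} → MaxFalse f₁ q → lookup q u ≡ true
  maxFalse₁-u {q} (fq , maximal) =
    subst (λ w → lookup w u ≡ true) (maximal (q [ u ]≔ true) (⪯-[]≔true q u) (trans (f₁-[]≔ q true) fq))
          (lookup∘update u q true)

  minTrue₁-u : ∀ {r} → MinTrue f₁ r → lookup r u ≡ false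
  minTrue₁-u {r} (fr , minimal) =
    subst (λ w → lookup w u ≡ false) (minimal (r [ u ]≔ false) ([]≔false-⪯ r u) (trans (f₁-[]≔ r false) fr))
          (lookup∘update u r false)

  extremal₁-u : ∀ {x} → Extremal f₁ x → lookup x u ≡ not (f₁ x)
  extremal₁-u (inj₁ maxFalse) = trans (maxFalse₁-u maxFalse) (cong not (sym (proj₁ maxFalse)))
  extremal₁-u (inj₂ minTrue)  = trans (minTrue₁-u minTrue) (cong not (sym (proj₁ minTrue)))

  lift : Point n → Point n
  lift x = if f x then x else x [ u ]≔ true

  lift-cases : ∀ x → (f x ≡ true × lift x ≡ x) ⊎ (f x ≡ false × lift x ≡ x [ u ]≔ true)
  lift-cases x with f x
  ... | true  = inj₁ (refl , refl)
  ... | false = inj₂ (refl , refl)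

  lift-[]≔ : ∀ x → lift x [ u ]≔ true ≡ x [ u ]≔ true
  lift-[]≔ x with lift-cases x
  ... | inj₁ (_ , eq) = cong (_[ u ]≔ true) eq
  ... | inj₂ (_ , eq) = trans (cong (_[ u ]≔ true) eq) ([]≔-idempotent x u)

  f₁-lift : ∀ x → f₁ (lift x) ≡ f₁ x
  f₁-lift x = cong f (lift-[]≔ x)

  lift-injective : ∀ {x y} → Extremal f₁ x → Extremal f₁ y → lift x ≡ lift y → x ≡ y
  lift-injective {x} {y} ex ey eq = []≔-injective same-u (begin
    x [ u ]≔ true      ≡⟨ lift-[]≔ x ⟨
    lift x [ u ]≔ true ≡⟨ cong (_[ u ]≔ true) eq ⟩
    lift y [ u ]≔ true ≡⟨ lift-[]≔ y ⟩
    y [ u ]≔ true      ∎)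
    where
    open ≡-Reasoning
    same-u : lookup x u ≡ lookup y u
    same-u = begin
      lookup x u        ≡⟨ extremal₁-u ex ⟩
      not (f₁ x)        ≡⟨ cong not (f₁-lift x) ⟨
      not (f₁ (lift x)) ≡⟨ cong (not ∘ f₁) eq ⟩
      not (f₁ (lift y)) ≡⟨ cong not (f₁-lift y) ⟩
      not (f₁ y)        ≡⟨ extremal₁-u ey ⟨
      lookup y u        ∎

  maxFalse-lift : ∀ {q} → MaxFalse f₁ q → MaxFalse f q
  maxFalse-lift {q} (f₁q , maximal) = trans (cong f (sym ([]≔-id qu))) f₁q , λ y q⪯y fy →
    maximal y q⪯y (trans (cong f ([]≔-id (q⪯y u qu))) fy)
    where
    qu = maxFalse₁-u (f₁q , maximal)

  minTrue-lift-true : ∀ {r} → MinTrue f₁ r → f r ≡ true → MinTrue f r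
  minTrue-lift-true (_ , minimal) fr = fr , λ y y⪯r fy → minimal y y⪯r (≤-⟨≔true⟩ pos u fy)

  minTrue-lift-false : ∀ {r} → MinTrue f₁ r → f r ≡ false → MinTrue f (r [ u ]≔ true)
  minTrue-lift-false {r} (f₁r , minimal) fr = f₁r , minimal′
    where
    minimal′ : ∀ y → y ⪯ (r [ u ]≔ true) → f y ≡ true → y ≡ r [ u ]≔ true
    minimal′ y y⪯r₁ fy with lookup y u in yu
    ... | false = contradiction (trans (cong f (sym y≡r)) fy) (not-¬ fr)
      where
      y≡r = minimal y (⪯-[]≔true⁻ y r u y⪯r₁ yu) (≤-⟨≔true⟩ pos u fy)
    ... | true  = begin
      y                            ≡⟨ []≔-id yu ⟨
      y [ u ]≔ true                ≡⟨ []≔-idempotent y u ⟨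
      (y [ u ]≔ false) [ u ]≔ true ≡⟨ cong (_[ u ]≔ true) (minimal y₀ y₀⪯r f₁y₀) ⟩
      r [ u ]≔ true                ∎
      where
      open ≡-Reasoning
      y₀ = y [ u ]≔ false
      y₀⪯r = ⪯-[]≔true⁻ y₀ r u (⪯-trans y₀ y (r [ u ]≔ true) ([]≔false-⪯ y u) y⪯r₁)
                        (lookup∘update u y false)
      f₁y₀ = trans (f₁-[]≔ y false) (trans (cong f ([]≔-id yu)) fy)

  lift-extremal : ∀ {x} → Extremal f₁ x → Extremal f (lift x)
  lift-extremal {x} (inj₁ maxFalse) with lift-cases x
  ... | inj₁ (fx , _)  = contradiction (≤-⟨≔true⟩ pos u fx) (not-¬ (proj₁ maxFalse))
  ... | inj₂ (_ , eq)  =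
    inj₁ (subst (MaxFalse f) (trans (sym ([]≔-id (maxFalse₁-u maxFalse))) (sym eq)) (maxFalse-lift maxFalse))
  lift-extremal {x} (inj₂ minTrue) with lift-cases x
  ... | inj₁ (fx , eq) = inj₂ (subst (MinTrue f) (sym eq) (minTrue-lift-true minTrue fx))
  ... | inj₂ (fx , eq) = inj₂ (subst (MinTrue f) (sym eq) (minTrue-lift-false minTrue fx))

  lift-family : ∀ {N} → AtLeastExtremal f₁ N → AtLeastExtremal f N
  lift-family (e , e-injective , e-extremal) =
    lift ∘ e ,
    (λ eq → e-injective (lift-injective (e-extremal _) (e-extremal _) eq)) ,
    lift-extremal ∘ e-extremal

  NotLifted : Point n → Set
  NotLifted x = ∀ z → Extremal f₁ z → lift z ≢ x

  lift-u-false : ∀ {z} → Extremal f₁ z → lookup (lift z) u ≡ false →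
                 f (lift z) ≡ true × MinTrue f₁ (lift z)
  lift-u-false {z} ez zu with lift-cases z | ez
  ... | inj₂ (_ , eq)  | _            = contradiction (trans (sym (cong (λ w → lookup w u) eq)) zu)
                                                      (not-¬ (lookup∘update u z true))
  ... | inj₁ (fz , _)  | inj₁ maxFalse = contradiction (≤-⟨≔true⟩ pos u fz) (not-¬ (proj₁ maxFalse))
  ... | inj₁ (fz , eq) | inj₂ minTrue  = trans (cong f eq) fz , subst (MinTrue f₁) (sym eq) minTrue

  false-notLifted : ∀ {x} → f x ≡ false → lookup x u ≡ false → NotLifted x
  false-notLifted fx xu z ez refl = contradiction fx (not-¬ (proj₁ (lift-u-false ez xu)))

  lift-one : Sensitive f u → ∀ {N} → AtLeastExtremal f₁ N → AtLeastExtremal f (suc N)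
  lift-one su E@(e , _ , e-extremal) with sensitive-maxFalse pos su
  ... | q , q-maxFalse , qu =
    extend (lift-family E) (inj₁ q-maxFalse) λ a → false-notLifted (proj₁ q-maxFalse) qu (e a) (e-extremal a)

  splitting-partner : NonSplit f → Splits f₁ →
                      ∃ λ v → v ≢ u × (∀ x → lookup x u ≡ true → lookup x v ≡ true → f x ≡ true)
  splitting-partner nonSplit (j , inj₁ f₁-low) with proj₁ (nonSplit j)
  ... | x , fx = contradiction (f₁-low x) (not-¬ (≤-⟨≔true⟩ pos u fx))
  splitting-partner nonSplit (v , inj₂ f₁-high) with v ≟ u
  ... | yes refl with proj₂ (nonSplit v)
  ...   | y , fy = contradiction (trans (sym (f₁-[]≔ y true)) (f₁-high y)) (not-¬ fy)
  splitting-partner nonSplit (v , inj₂ f₁-high) | no v≢u = v , v≢u , forced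
    where
    forced : ∀ x → lookup x u ≡ true → lookup x v ≡ true → f x ≡ true
    forced x xu xv = trans (cong f (sym (trans (cong (_[ u ]≔ true) ([]≔-id xv)) ([]≔-id xu)))) (f₁-high x)

  NewPair : Set
  NewPair = ∃ λ x₁ → ∃ λ x₂ → Extremal f x₁ × Extremal f x₂ × x₁ ≢ x₂ × NotLifted x₁ × NotLifted x₂

  module _ (nonSplit : NonSplit f) {v} (v≢u : v ≢ u)
           (forced : ∀ x → lookup x u ≡ true → lookup x v ≡ true → f x ≡ true) where

    maxFalse-raising-v : ∀ y → f (y [ v ]≔ true) ≡ false →
                         ∃ λ q → MaxFalse f q × (y [ v ]≔ true) ⪯ q × NotLifted q
    maxFalse-raising-v y fy = q , q-maxFalse , y⪯q , false-notLifted (proj₁ q-maxFalse) qu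
      where
      q = ascend f (y [ v ]≔ true)
      q-maxFalse = ascend-maxFalse pos (y [ v ]≔ true) fy
      y⪯q = ascend-⪰ f (y [ v ]≔ true) fy
      qu : lookup q u ≡ false
      qu = ¬-not λ qu → not-¬ (forced q qu (y⪯q v (lookup∘update v y true))) (proj₁ q-maxFalse)

    newPair-minTrue : ∀ {q} → MaxFalse f q → lookup q v ≡ true → NotLifted q →
                      Sensitive (f ⟨ u ≔ false ⟩) v → NewPair
    newPair-minTrue {q} q-maxFalse qv q-new (x , f0 , f1) =
      q , p , inj₁ q-maxFalse , inj₂ p-minTrue , q≢p , q-new , p-new
      where
      z = (x [ v ]≔ true) [ u ]≔ false
      p = descend f z
      p-minTrue = descend-minTrue pos z f1
      p⪯z = descend-⪯ pos z f1
      q≢p : q ≢ p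
      q≢p refl = contradiction (proj₁ p-minTrue) (not-¬ (proj₁ q-maxFalse))
      pu : lookup p u ≡ false
      pu = ¬-not λ pu → not-¬ (p⪯z u pu) (lookup∘update u (x [ v ]≔ true) false)
      z-v : z [ v ]≔ false ≡ (x [ v ]≔ false) [ u ]≔ false
      z-v = trans ([]≔-commutes (x [ v ]≔ true) u v (v≢u ∘ sym))
                  (cong (_[ u ]≔ false) ([]≔-idempotent x v))
      pv : lookup p v ≡ true
      pv = ¬-not λ pv → not-¬ (proj₁ p-minTrue)
                               (positive-false pos (trans (cong f z-v) f0) (⪯-[]≔false p z v p⪯z pv))
      eᵥ = replicate n false [ v ]≔ true
      f-eᵥ : f eᵥ ≡ false
      f-eᵥ = positive-false pos (proj₁ q-maxFalse) ([]≔true-⪯ (replicate n false) q v (replicate-⪯ q) qv)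
      f₁-eᵥ : f₁ eᵥ ≡ true
      f₁-eᵥ = forced (eᵥ [ u ]≔ true) (lookup∘update u eᵥ true)
                     (trans (lookup∘update′ v≢u eᵥ true) (lookup∘update v (replicate n false) true))
      -- A lift with x_u = 0 is a minimal true point of f₁; lying above eᵥ, it would be eᵥ.
      p-new : NotLifted p
      p-new z′ ez′ lifted = contradiction (trans (cong f (sym eᵥ≡p)) f-eᵥ) (not-¬ (proj₁ p-minTrue))
        where
        p-minTrue₁ : MinTrue f₁ p
        p-minTrue₁ = subst (MinTrue f₁) lifted
          (proj₂ (lift-u-false ez′ (subst (λ w → lookup w u ≡ false) (sym lifted) pu)))
        eᵥ≡p : eᵥ ≡ p
        eᵥ≡p = proj₂ p-minTrue₁ eᵥ ([]≔true-⪯ (replicate n false) p v (replicate-⪯ p) pv) f₁-eᵥ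

    maxFalse-gap : ∀ {q} → MaxFalse f q → ∃ λ w → lookup q w ≡ false × w ≢ u
    maxFalse-gap {q} (fq , _) with any? (λ w → (lookup q w ≟ᴮ false) ×-dec ¬? (w ≟ u))
    ... | yes gap = gap
    ... | no ¬gap with proj₁ (nonSplit u)
    ...   | x , fx = contradiction (pos (x [ u ]≔ false) q fx below-q) (not-¬ fq)
      where
      below-q : (x [ u ]≔ false) ⪯ q
      below-q = []≔-⪯ x q u false (λ i i≢u _ → ¬-not λ qi → ¬gap (i , qi , i≢u)) λ ()

    newPair-maxFalse : ∀ {q} → MaxFalse f q → lookup q v ≡ true → NotLifted q →
                       ¬ Sensitive (f ⟨ u ≔ false ⟩) v → NewPair
    newPair-maxFalse {q} q-maxFalse qv q-new ¬sensitive with maxFalse-gap q-maxFalse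
    ... | w , qw , w≢u with proj₂ (nonSplit w)
    ...   | y , fy with maxFalse-raising-v ((y [ w ]≔ true) [ u ]≔ false) f-raised
      where
      y₁ = y [ w ]≔ true
      f-raised : f ((y₁ [ u ]≔ false) [ v ]≔ true) ≡ false
      f-raised = trans (cong f ([]≔-commutes y₁ u v (v≢u ∘ sym)))
                   (trans (insensitive-invariant (positive-⟨≔⟩ pos u false) ¬sensitive y₁ true)
                          (positive-false pos fy ([]≔false-⪯ y₁ u)))
    ...     | q′ , q′-maxFalse , raised⪯q′ , q′-new =
      q , q′ , inj₁ q-maxFalse , inj₁ q′-maxFalse , q≢q′ , q-new , q′-new
      where
      w≢v : w ≢ v
      w≢v refl = contradiction qv (not-¬ qw)
      q′w : lookup q′ w ≡ true
      q′w = raised⪯q′ w (trans (lookup∘update′ w≢v ((y [ w ]≔ true) [ u ]≔ false) true)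
                              (trans (lookup∘update′ w≢u (y [ w ]≔ true) false) (lookup∘update w y true)))
      q≢q′ : q ≢ q′
      q≢q′ refl = contradiction q′w (not-¬ qw)

    newPair : NewPair
    newPair with proj₂ (nonSplit v)
    ... | y , fy with maxFalse-raising-v y fy
    ...   | q , q-maxFalse , raised⪯q , q-new =
      [ newPair-minTrue q-maxFalse qv q-new , newPair-maxFalse q-maxFalse qv q-new ]′
        (toSum (sensitive? (f ⟨ u ≔ false ⟩) v))
      where qv = raised⪯q v (lookup∘update v y true)

  lift-two : NonSplit f → Splits f₁ → ∀ {N} → AtLeastExtremal f₁ N → AtLeastExtremal f (suc (suc N))
  lift-two nonSplit splits E@(e , _ , e-extremal) with splitting-partner nonSplit splits
  ... | v , v≢u , forced with newPair nonSplit v≢u forced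
  ...   | x₁ , x₂ , x₁-extremal , x₂-extremal , x₁≢x₂ , x₁-new , x₂-new =
    extend (extend (lift-family E) x₁-extremal λ a → x₁-new (e a) (e-extremal a)) x₂-extremal λ where
      zero    → x₁≢x₂
      (suc a) → x₂-new (e a) (e-extremal a)

ExtremalBound : BF n → ℕ → Set
ExtremalBound f k = AtLeastExtremal f (suc k) × (NonSplit f → AtLeastExtremal f (suc (suc k)))

extremalBound-dual : ∀ (f : BF n) {k} → ExtremalBound (dual f) k → ExtremalBound f k
extremalBound-dual f (bound , bound-nonSplit) =
  atLeastExtremal-dual bound , atLeastExtremal-dual ∘ bound-nonSplit ∘ nonSplit-dual f

lift-bound : ∀ (f : BF n) → Positive f → ∀ {u} → Sensitive f u →
             ∀ {k} → ExtremalBound (f ⟨ u ≔ true ⟩) k → ExtremalBound f (suc k)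
lift-bound f pos {u} su (bound , bound-nonSplit) = lift-one su bound , λ nonSplit →
  [ lift-one su ∘ bound-nonSplit , (λ splits → lift-two nonSplit splits bound) ]′ (nonSplit-or-splits f₁)
  where open Lift pos u

invariant⇒constant : ∀ (g : BF n) → (∀ j x b → g (x [ j ]≔ b) ≡ g x) → ∀ x → g x ≡ g (replicate n false)
invariant⇒constant {zero}  g _         []      = refl
invariant⇒constant {suc n} g invariant (c ∷ x) =
  trans (sym (invariant zero (c ∷ x) false))
        (invariant⇒constant (g ∘ (false ∷_)) (λ j y → invariant (suc j) (false ∷ y)) x)

extremalBound-insensitive : ∀ {m} (f : BF (suc m)) → Positive f → (∀ j → ¬ Sensitive f j) →
                            ExtremalBound f 0
extremalBound-insensitive {m} f pos insensitive = one , ⊥-elim ∘ not-nonSplit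
  where
  one : AtLeastExtremal f 1
  one = extend ((λ ()) , (λ { {()} }) , λ ()) (proj₂ (extremal-exists pos (replicate (suc m) false))) λ ()
  f-constant = invariant⇒constant f λ j → insensitive-invariant pos (insensitive j)
  not-nonSplit : ¬ NonSplit f
  not-nonSplit nonSplit with nonSplit zero
  ... | (x , fx) , (y , fy) = not-¬ (trans (trans (f-constant _) (sym (f-constant _))) fx) fy

record RegularPositive (f : BF n) (k : ℕ) : Set where
  field
    positive    : Positive f
    regular     : Regular f
    ι           : Fin k → Fin n
    ι-injective : Injective _≡_ _≡_ ι
    sensitive⇔  : ∀ j → Sensitive f j ⇔ ∃ λ a → ι a ≡ j

  sensitive-ι : ∀ a → Sensitive f (ι a)
  sensitive-ι a = Equivalence.from (sensitive⇔ (ι a)) (a , refl)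

open RegularPositive

regularPositive-dual : ∀ {f : BF n} {k} → RegularPositive f k → RegularPositive (dual f) k
regularPositive-dual {f = f} R = record
  { positive    = dual-positive (positive R)
  ; regular     = regular-dual f (regular R)
  ; ι           = ι R
  ; ι-injective = ι-injective R
  ; sensitive⇔  = λ j → mk⇔ (Equivalence.to (sensitive⇔ R j) ∘ sensitive-dual⁻ f)
                             (sensitive-dual f ∘ Equivalence.from (sensitive⇔ R j))
  }

regularPositive-⟨≔⟩ : ∀ {f : BF n} {k} (R : RegularPositive f (suc k)) a₀ {b} →
                      KeepsSensitive f (ι R a₀) b → RegularPositive (f ⟨ ι R a₀ ≔ b ⟩) k
regularPositive-⟨≔⟩ {f = f} R a₀ {b} keeps = record
  { positive    = positive-⟨≔⟩ (positive R) u b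
  ; regular     = regular-⟨≔⟩ f u b (regular R)
  ; ι           = ι R ∘ punchIn a₀
  ; ι-injective = λ eq → punchIn-injective a₀ _ _ (ι-injective R eq)
  ; sensitive⇔  = λ j → mk⇔ to from
  }
  where
  u = ι R a₀
  to : ∀ {j} → Sensitive (f ⟨ u ≔ b ⟩) j → ∃ λ a → ι R (punchIn a₀ a) ≡ j
  to {j} s with sensitive-⟨≔⟩⁻ f u b s
  ... | sj , j≢u with Equivalence.to (sensitive⇔ R j) sj
  ...   | a , refl = punchOut a₀≢a , cong (ι R) (punchIn-punchOut a₀≢a)
    where
    a₀≢a : a₀ ≢ a
    a₀≢a refl = j≢u refl
  from : ∀ {j} → (∃ λ a → ι R (punchIn a₀ a) ≡ j) → Sensitive (f ⟨ u ≔ b ⟩) j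
  from (a , refl) = keeps _ (sensitive-ι R (punchIn a₀ a)) (punchInᵢ≢i a₀ a ∘ ι-injective R)

weakest-sensitive : ∀ {f : BF n} {k} (R : RegularPositive f (suc k)) → ∃ λ a₀ → Weakest f (ι R a₀)
weakest-sensitive {f = f} {k} R = a₀ , weakest
  where
  open Extrema (DecTotalOrder.totalOrder ℚ.≤-decTotalOrder) using (argmin; f[argmin]≤f[xs])
  w = proj₁ (regular R)
  a₀ = argmin (w ∘ ι R) zero (allFin (suc k))
  weakest : Weakest f (ι R a₀)
  weakest v sv with Equivalence.to (sensitive⇔ R v) sv
  ... | a , refl = proj₂ (regular R) (ι R a₀) (ι R a) (sensitive-ι R a₀) sv
                     (All.lookup (f[argmin]≤f[xs] {f = w ∘ ι R} zero (allFin (suc k))) (∈-allFin a))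

extremalBound : ∀ {m} k (f : BF (suc m)) → RegularPositive f k → ExtremalBound f k
extremalBound zero    f R =
  extremalBound-insensitive f (positive R) λ j s → case Equivalence.to (sensitive⇔ R j) s of λ ()
extremalBound (suc k) f R with weakest-sensitive R
... | a₀ , weakest with weakest-dichotomy (positive R) weakest
...   | inj₁ keeps = lift-bound f (positive R) (sensitive-ι R a₀)
                       (extremalBound k _ (regularPositive-⟨≔⟩ R a₀ keeps))
...   | inj₂ keeps = extremalBound-dual f (lift-bound (dual f) (positive R′) (sensitive-ι R′ a₀)
                       (extremalBound k _ (regularPositive-⟨≔⟩ R′ a₀ (keepsSensitive-dual f (ι R a₀) keeps))))
  where
  R′ = regularPositive-dual R

insertAt-[]≔ : ∀ (y : Point n) j b c → insertAt y j c [ j ]≔ b ≡ insertAt y j b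
insertAt-[]≔ y       zero    b c = refl
insertAt-[]≔ (a ∷ y) (suc j) b c = cong (a ∷_) (insertAt-[]≔ y j b c)

restrict-⟨≔⟩ : ∀ (f : BF (suc n)) j b c y → restrict f j b y ≡ (f ⟨ j ≔ b ⟩) (insertAt y j c)
restrict-⟨≔⟩ f j b c y = cong f (sym (insertAt-[]≔ y j b c))

insertAt-removeAt : ∀ (x : Point (suc n)) j b → insertAt (removeAt x j) j b ≡ x [ j ]≔ b
insertAt-removeAt (a ∷ x)      zero    b = refl
insertAt-removeAt (a ∷ a′ ∷ x) (suc j) b = cong (a ∷_) (insertAt-removeAt (a′ ∷ x) j b)

module _ {m} {f : BF (suc m)} (pos : Positive f) where

  relevant⇔sensitive : ∀ j → Relevant f j ⇔ Sensitive f j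
  relevant⇔sensitive j = mk⇔ to from
    where
    flat : ¬ Sensitive f j → ∀ y b → restrict f j b y ≡ f (insertAt y j false)
    flat ¬sensitive y b =
      trans (restrict-⟨≔⟩ f j b false y) (insensitive-invariant pos ¬sensitive (insertAt y j false) b)
    to : Relevant f j → Sensitive f j
    to relevant = decidable-stable (sensitive? f j) λ ¬sensitive →
      relevant λ y → trans (flat ¬sensitive y false) (sym (flat ¬sensitive y true))
    from : Sensitive f j → Relevant f j
    from (x , f0 , f1) irrelevant = not-¬ (begin
      f (x [ j ]≔ false)                ≡⟨ cong f (insertAt-removeAt x j false) ⟨
      restrict f j false (removeAt x j) ≡⟨ irrelevant (removeAt x j) ⟩
      restrict f j true (removeAt x j)  ≡⟨ cong f (insertAt-removeAt x j true) ⟩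
      f (x [ j ]≔ true)                 ≡⟨ f1 ⟩
      true                              ∎) f0
      where open ≡-Reasoning

  regularPositive : ∀ {k} → Threshold f → HasRelevantCount f k → RegularPositive f k
  regularPositive threshold (ι , ι-injective , relevant⇔) = record
    { positive    = pos
    ; regular     = threshold-regular f threshold
    ; ι           = ι
    ; ι-injective = ι-injective
    ; sensitive⇔  = λ j → ⇔-trans (⇔-sym (relevant⇔sensitive j)) (relevant⇔ j)
    }

nonSplit : ∀ {m} (f : BF (suc m)) → ¬ Split f → NonSplit f
nonSplit f ¬split with nonSplit-or-splits f
... | inj₁ nonSplit        = nonSplit
... | inj₂ (j , inj₁ low)  = contradiction (j , inj₁ λ y → trans (restrict-⟨≔⟩ f j false false y) (low _)) ¬split
... | inj₂ (j , inj₂ high) = contradiction (j , inj₂ λ y → trans (restrict-⟨≔⟩ f j true true y) (high _)) ¬split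

lemma3 : (m : ℕ) (f : BF (suc m)) (k : ℕ) →
    Positive f → Threshold f → ¬ Split f → HasRelevantCount f k →
    (i : Fin (suc m)) → Split (restrict f i false) → Split (restrict f i true) →
    AtLeastExtremal f (k + 2)
lemma3 m f k pos threshold ¬split count _ _ _ =
  subst (AtLeastExtremal f) (+-comm 2 k)
    (proj₂ (extremalBound k f (regularPositive pos threshold count)) (nonSplit f ¬split))
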